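{- Let $M$ be a loopless matroid on a finite set $E$ with rank function $r$. For subsets $S_1,\ldots,S_k \subseteq E$ put $\tilde r(S_1,\ldots,S_k) := \sum_{i=1}^k (2r(S_i)-1)$, and define $r': 2^E \to \mathbb{N}$ by \[ r'(S) := \min \tilde r(P_1,\ldots,P_k), \] the minimum taken over all partitions $\{P_1,\ldots,P_k\}$ of $S$. Then $r'$ is the rank function of a matroid $M'$ on $E$.
   Context: A partition of a finite set $S$ is a set of pairwise disjoint nonempty subsets of $S$ whose union is $S$; the empty set has the empty partition (with $k=0$, giving value $0$). -}

module Defs where

open import Data.Nat using (ℕ; _+_; _*_; _∸_; _≤_)
open import Data.Fin using (Fin)
open import Data.Fin.Subset using (Subset; _⊆_; _∪_; _∩_; ∣_∣; ⁅_⁆; Nonempty)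
  renaming (⊥ to ∅)
open import Data.List using (List; []; _∷_; foldr; map)
open import Data.Nat.ListAction using (sum)
open import Data.List.Relation.Unary.All using (All)
open import Data.List.Relation.Unary.AllPairs using (AllPairs)
open import Data.Product using (Σ; _×_; ∃)
open import Relation.Binary.PropositionalEquality using (_≡_)
open import Relation.Nullary using (¬_)

-- A function r : 2^E → ℕ is a matroid rank function (standard rank axioms;
-- nonnegativity is automatic in ℕ).
record IsRankFunction {n : ℕ} (r : Subset n → ℕ) : Set where
  field
    bounded    : ∀ S → r S ≤ ∣ S ∣
    monotone   : ∀ {S T} → S ⊆ T → r S ≤ r T
    submodular : ∀ S T → r (S ∪ T) + r (S ∩ T) ≤ r S + r T

record Matroid (n : ℕ) : Set where
  field
    rank    : Subset n → ℕ
    isRank  : IsRankFunction rank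

Loopless : ∀ {n} → Matroid n → Set
Loopless {n} M = ∀ (e : Fin n) → ¬ (Matroid.rank M ⁅ e ⁆ ≡ 0)

Disjoint : ∀ {n} → Subset n → Subset n → Set
Disjoint A B = A ∩ B ≡ ∅

⋃ : ∀ {n} → List (Subset n) → Subset n
⋃ = foldr _∪_ ∅

-- A list of blocks P₁,…,Pₖ is a partition of S: blocks nonempty,
-- pairwise disjoint, union S.  (k = 0 allowed, only for S = ∅.)
IsPartition : ∀ {n} → Subset n → List (Subset n) → Set
IsPartition S Ps = All Nonempty Ps × AllPairs Disjoint Ps × ⋃ Ps ≡ S

r̃ : ∀ {n} → (Subset n → ℕ) → List (Subset n) → ℕ
r̃ r Ps = sum (map (λ P → 2 * r P ∸ 1) Ps)

IsMinOverPartitions : ∀ {n} → (Subset n → ℕ) → Subset n → ℕ → Set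
IsMinOverPartitions r S m =
  (Σ (List _) λ Ps → IsPartition S Ps × r̃ r Ps ≡ m)
  × (∀ Ps → IsPartition S Ps → m ≤ r̃ r Ps)

{-# OPTIONS --safe #-}
-- f = 2r ∸ 1 is monotone, at most 1 on singletons, and, because a loopless matroid has
-- positive rank on nonempty sets, submodular on every pair of sets that meet.  These three
-- properties of f alone make r′(S) = min Σ f(Pᵢ) over partitions of S a rank function.
-- The minimum exists by well-founded recursion along ⊂, since a partition of S is a
-- nonempty first block A ⊆ S followed by a partition of S ─ A.  For submodularity, add
-- the blocks Q of an optimal partition of T to S one at a time; to bound
-- r′(W ∪ Q) + r′(W ∩ Q) take an optimal partition of W and sweep Q through it: blocks
-- disjoint from Q stay blocks of W ∪ Q, a block Wᵢ meeting Q is merged into Q while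
-- Wᵢ ∩ Q becomes a block of W ∩ Q, and intersecting submodularity of f pays for each merge.
module Submission where

open import Defs
open import Data.Nat using (ℕ; zero; suc; _+_; _*_; _∸_; _≤_; z≤n; s≤s; s≤s⁻¹)
open import Data.Nat.Properties
open import Data.Nat.ListAction using (sum)
open import Algebra.Properties.CommutativeSemigroup +-commutativeSemigroup
  using (x∙yz≈xz∙y; x∙yz≈yx∙z; xy∙z≈xz∙y; xy∙z≈x∙zy)
open import Data.Bool using (true; false)
open import Data.Vec using ([]; _∷_; here; there)
open import Data.Fin as Fin using (Fin)
open import Data.Fin.Subset
  using (Subset; _⊆_; _⊂_; _∪_; _∩_; _─_; _-_; ∣_∣; ⁅_⁆; Nonempty; _∈_; _∉_)
  renaming (⊥ to ∅)
open import Data.Fin.Subset.Properties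
open import Data.Fin.Subset.Induction using (⊂-wellFounded)
open import Data.List using (List; []; _∷_; [_]; map; _++_)
open import Data.List.Relation.Unary.All using (All; []; _∷_; universal)
open import Data.List.Relation.Unary.All.Properties using () renaming (map⁺ to All-map⁺)
open import Data.List.Relation.Unary.AllPairs using (AllPairs; []; _∷_)
import Data.List.Relation.Unary.Any as Any
open import Data.List.Relation.Unary.Any.Properties using () renaming (map⁺ to Any-map⁺)
open import Data.List.Membership.Propositional using (lose) renaming (_∈_ to _∈ₗ_)
open import Data.List.Membership.Propositional.Properties using (∈-map⁺; ∈-++⁺ˡ; ∈-++⁺ʳ)
open import Data.List.Extrema.Nat using (argmin; f[argmin]≤v⁺; argmin-all)
open import Data.Product using (Σ; _×_; _,_; proj₁; proj₂)
open import Data.Sum using (inj₁; inj₂; [_,_]′)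
open import Data.Empty using (⊥-elim)
open import Function using (_∘_)
open import Induction.WellFounded using (module All)
open import Level using (0ℓ)
open import Relation.Nullary using (yes; no)
open import Relation.Nullary.Decidable using (_×-dec_)
open import Relation.Binary.PropositionalEquality
  using (_≡_; refl; sym; trans; cong; cong₂; subst; module ≡-Reasoning)

private variable
  n : ℕ
  x : Fin n
  A B C S T : Subset n
  Ps : List (Subset n)

x∈p─q⁻ : ∀ (p q : Subset n) → x ∈ p ─ q → x ∈ p × x ∉ q
x∈p─q⁻ (true ∷ p) (false ∷ q) here = here , λ ()
x∈p─q⁻ {x = Fin.zero} (false ∷ p) (true ∷ q) ()
x∈p─q⁻ {x = Fin.zero} (false ∷ p) (false ∷ q) ()
x∈p─q⁻ (_ ∷ p) (_ ∷ q) (there x∈p─q) with x∈p─q⁻ p q x∈p─q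
... | x∈p , x∉q = there x∈p , x∉q ∘ drop-there

p⊆q⇒p∪[q─p]≡q : A ⊆ S → A ∪ (S ─ A) ≡ S
p⊆q⇒p∪[q─p]≡q {A = A} {S = S} A⊆S = ⊆-antisym ⊆S ⊇S
  where
  ⊆S : A ∪ (S ─ A) ⊆ S
  ⊆S x∈ with x∈p∪q⁻ A (S ─ A) x∈
  ... | inj₁ x∈A = A⊆S x∈A
  ... | inj₂ x∈S─A = proj₁ (x∈p─q⁻ S A x∈S─A)
  ⊇S : S ⊆ A ∪ (S ─ A)
  ⊇S {x} x∈S with x ∈? A
  ... | yes x∈A = x∈p∪q⁺ (inj₁ x∈A)
  ... | no x∉A = x∈p∪q⁺ (inj₂ (x∈p∧x∉q⇒x∈p─q x∈S x∉A))

p⊆q∪r⇒p─p∩q⊆r : S ⊆ A ∪ B → S ─ (S ∩ A) ⊆ B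
p⊆q∪r⇒p─p∩q⊆r {S = S} {A = A} {B = B} S⊆A∪B x∈ with x∈p─q⁻ S (S ∩ A) x∈
... | x∈S , x∉S∩A with x∈p∪q⁻ A B (S⊆A∪B x∈S)
...   | inj₁ x∈A = ⊥-elim (x∉S∩A (x∈p∩q⁺ (x∈S , x∈A)))
...   | inj₂ x∈B = x∈B

x∈p⇒⁅x⁆⊆p : x ∈ S → ⁅ x ⁆ ⊆ S
x∈p⇒⁅x⁆⊆p {S = S} x∈S {y} y∈⁅x⁆ = subst (_∈ S) (sym (x∈⁅y⁆⇒x≡y _ y∈⁅x⁆)) x∈S

∩-mono-⊆ : A ⊆ B → C ⊆ S → A ∩ C ⊆ B ∩ S
∩-mono-⊆ {A = A} {C = C} A⊆B C⊆S x∈A∩C =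
  let (x∈A , x∈C) = x∈p∩q⁻ A C x∈A∩C in x∈p∩q⁺ (A⊆B x∈A , C⊆S x∈C)

Disjoint⁺ : (∀ {x} → x ∈ A → x ∉ B) → Disjoint A B
Disjoint⁺ {A = A} {B = B} h =
  Empty-unique λ (x , x∈A∩B) → let (x∈A , x∈B) = x∈p∩q⁻ A B x∈A∩B in h x∈A x∈B

Disjoint⁻ : Disjoint A B → x ∈ A → x ∉ B
Disjoint⁻ {x = x} A#B x∈A x∈B = ∉⊥ (subst (x ∈_) A#B (x∈p∩q⁺ (x∈A , x∈B)))

Disjoint-mono : A ⊆ C → B ⊆ S → Disjoint C S → Disjoint A B
Disjoint-mono A⊆C B⊆S C#S = Disjoint⁺ λ x∈A x∈B → Disjoint⁻ C#S (A⊆C x∈A) (B⊆S x∈B)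

Disjoint-∪ʳ : Disjoint A B → Disjoint A C → Disjoint A (B ∪ C)
Disjoint-∪ʳ {B = B} {C = C} A#B A#C = Disjoint⁺ λ x∈A x∈B∪C →
  [ Disjoint⁻ A#B x∈A , Disjoint⁻ A#C x∈A ]′ (x∈p∪q⁻ B C x∈B∪C)

Disjoint-─ : Disjoint A (S ─ A)
Disjoint-─ {A = A} {S = S} = Disjoint⁺ λ x∈A x∈S─A → proj₂ (x∈p─q⁻ S A x∈S─A) x∈A

Disjoint-⋃⁺ : ∀ Ps → All (Disjoint A) Ps → Disjoint A (⋃ Ps)
Disjoint-⋃⁺ {A = A} [] [] = ∩-zeroʳ A
Disjoint-⋃⁺ (P ∷ Ps) (A#P ∷ A#Ps) = Disjoint-∪ʳ A#P (Disjoint-⋃⁺ Ps A#Ps)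

Disjoint-⋃⁻ : ∀ Ps → Disjoint A (⋃ Ps) → All (Disjoint A) Ps
Disjoint-⋃⁻ [] _ = []
Disjoint-⋃⁻ (P ∷ Ps) A#P∪U =
  Disjoint-mono ⊆-refl (p⊆p∪q (⋃ Ps)) A#P∪U
  ∷ Disjoint-⋃⁻ Ps (Disjoint-mono ⊆-refl (q⊆p∪q P (⋃ Ps)) A#P∪U)

[p∪q]─p≡q : Disjoint A B → (A ∪ B) ─ A ≡ B
[p∪q]─p≡q {A = A} {B = B} A#B = ⊆-antisym ⊆B ⊇B
  where
  ⊆B : (A ∪ B) ─ A ⊆ B
  ⊆B x∈ with x∈p─q⁻ (A ∪ B) A x∈
  ... | x∈A∪B , x∉A with x∈p∪q⁻ A B x∈A∪B
  ...   | inj₁ x∈A = ⊥-elim (x∉A x∈A)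
  ...   | inj₂ x∈B = x∈B
  ⊇B : B ⊆ (A ∪ B) ─ A
  ⊇B x∈B = x∈p∧x∉q⇒x∈p─q (q⊆p∪q A B x∈B) λ x∈A → Disjoint⁻ A#B x∈A x∈B

∷-isPartition : Nonempty A → Disjoint A S → IsPartition S Ps → IsPartition (A ∪ S) (A ∷ Ps)
∷-isPartition {A = A} {Ps = Ps} A≢∅ A#S (Ps≢∅ , Ps# , refl) =
  A≢∅ ∷ Ps≢∅ , Disjoint-⋃⁻ Ps A#S ∷ Ps# , refl

∷-isPartition′ : Nonempty A → A ⊆ S → IsPartition (S ─ A) Ps → IsPartition S (A ∷ Ps)
∷-isPartition′ {A = A} {Ps = Ps} A≢∅ A⊆S part =
  subst (λ T → IsPartition T (A ∷ Ps)) (p⊆q⇒p∪[q─p]≡q A⊆S) (∷-isPartition A≢∅ Disjoint-─ part)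

∷-isPartition⁻ : IsPartition S (A ∷ Ps) → Nonempty A × A ⊆ S × IsPartition (S ─ A) Ps
∷-isPartition⁻ {Ps = Ps} (A≢∅ ∷ Ps≢∅ , A#Ps ∷ Ps# , refl) =
  A≢∅ , p⊆p∪q (⋃ Ps) , Ps≢∅ , Ps# , sym ([p∪q]─p≡q (Disjoint-⋃⁺ Ps A#Ps))

[_]-isPartition : Nonempty S → IsPartition S [ S ]
[_]-isPartition {S = S} S≢∅ =
  subst (λ T → IsPartition T [ S ]) (∪-identityʳ S) (∷-isPartition S≢∅ (∩-zeroʳ S) ([] , [] , refl))

allSubsets : ∀ n → List (Subset n)
allSubsets zero = [ [] ]
allSubsets (suc n) = map (true ∷_) (allSubsets n) ++ map (false ∷_) (allSubsets n)

∈-allSubsets : ∀ (A : Subset n) → A ∈ₗ allSubsets n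
∈-allSubsets [] = Any.here refl
∈-allSubsets (true ∷ A) = ∈-++⁺ˡ (∈-map⁺ (true ∷_) (∈-allSubsets A))
∈-allSubsets {suc n} (false ∷ A) =
  ∈-++⁺ʳ (map (true ∷_) (allSubsets n)) (∈-map⁺ (false ∷_) (∈-allSubsets A))

module PartitionCost {n : ℕ} (f : Subset n → ℕ) where

  cost : List (Subset n) → ℕ
  cost Ps = sum (map f Ps)

  IsMinCost : Subset n → ℕ → Set
  IsMinCost S m =
    (Σ (List (Subset n)) λ Ps → IsPartition S Ps × cost Ps ≡ m)
    × (∀ Ps → IsPartition S Ps → m ≤ cost Ps)

  optimal : Σ ℕ (IsMinCost S) → List (Subset n)
  optimal (_ , (Ps , _) , _) = Ps

  optimal-isPartition : (m : Σ ℕ (IsMinCost S)) → IsPartition S (optimal m)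
  optimal-isPartition (_ , (_ , part , _) , _) = part

  optimal-≤ : (m : Σ ℕ (IsMinCost S)) → IsPartition S Ps → cost (optimal m) ≤ cost Ps
  optimal-≤ (_ , (_ , _ , refl) , lower) part = lower _ part

  minCost-fromDominatingFamily : (g : Subset n → List (Subset n)) →
    IsPartition S Ps → (∀ A → IsPartition S (g A)) →
    (∀ Qs → IsPartition S Qs → Σ (Subset n) λ A → cost (g A) ≤ cost Qs) →
    Σ ℕ (IsMinCost S)
  minCost-fromDominatingFamily {Ps = Ps} g part g-part g-dominates =
    cost best , (best , best-isPartition , refl) , best-≤
    where
    best : List (Subset n)
    best = argmin cost Ps (map g (allSubsets n))

    best-isPartition : IsPartition _ best
    best-isPartition =
      argmin-all cost {P = IsPartition _} part (All-map⁺ (universal g-part (allSubsets n)))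

    best-≤ : ∀ Qs → IsPartition _ Qs → cost best ≤ cost Qs
    best-≤ Qs Qs-part with g-dominates Qs Qs-part
    ... | A , gA≤Qs = f[argmin]≤v⁺ {f = cost} Ps (map g (allSubsets n))
                        (inj₂ (Any-map⁺ (lose (∈-allSubsets A) gA≤Qs)))

  minCost-step : ∀ S → (∀ {T} → T ⊂ S → Σ ℕ (IsMinCost T)) → Σ ℕ (IsMinCost S)
  minCost-step S rec with nonempty? S
  ... | no S≡∅ = 0 , ([] , ([] , [] , sym (Empty-unique S≡∅)) , refl) , λ _ _ → z≤n
  ... | yes S≢∅ =
    minCost-fromDominatingFamily extend [ S≢∅ ]-isPartition extend-isPartition dominates
    where
    rest : Nonempty A → A ⊆ S → Σ ℕ (IsMinCost (S ─ A))
    rest {A = A} (x , x∈A) A⊆S = rec (p∩q≢∅⇒p─q⊂p S A (x , x∈p∩q⁺ (A⊆S x∈A , x∈A)))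

    -- [ S ] is only a placeholder for the A that cannot be the first block of a partition of S.
    extend : Subset n → List (Subset n)
    extend A with nonempty? A ×-dec A ⊆? S
    ... | yes (A≢∅ , A⊆S) = A ∷ optimal (rest A≢∅ A⊆S)
    ... | no _ = [ S ]

    extend-isPartition : ∀ A → IsPartition S (extend A)
    extend-isPartition A with nonempty? A ×-dec A ⊆? S
    ... | yes (A≢∅ , A⊆S) = ∷-isPartition′ A≢∅ A⊆S (optimal-isPartition (rest A≢∅ A⊆S))
    ... | no _ = [ S≢∅ ]-isPartition

    dominates : ∀ Qs → IsPartition S Qs → Σ (Subset n) λ A → cost (extend A) ≤ cost Qs
    dominates [] (_ , _ , ∅≡S) = ⊥-elim (∉⊥ (subst (proj₁ S≢∅ ∈_) (sym ∅≡S) (proj₂ S≢∅)))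
    dominates (P ∷ Qs) part = P , extend-≤
      where
      extend-≤ : cost (extend P) ≤ f P + cost Qs
      extend-≤ with ∷-isPartition⁻ part | nonempty? P ×-dec P ⊆? S
      ... | _ , _ , Qs-part | yes (P≢∅ , P⊆S) =
        +-monoʳ-≤ (f P) (optimal-≤ (rest P≢∅ P⊆S) Qs-part)
      ... | P≢∅ , P⊆S , _ | no invalid = ⊥-elim (invalid (P≢∅ , P⊆S))

  minCost : ∀ S → Σ ℕ (IsMinCost S)
  minCost = All.wfRec ⊂-wellFounded 0ℓ (λ S → Σ ℕ (IsMinCost S)) minCost-step

  module MinCostProperties (r′ : Subset n → ℕ) (r′-min : ∀ S → IsMinCost S (r′ S)) where
    open ≤-Reasoning

    r′-≤-cost : IsPartition S Ps → r′ S ≤ cost Ps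
    r′-≤-cost part = proj₂ (r′-min _) _ part

    r′-attained : ∀ S (P : ℕ → Set) → (∀ {Ps} → IsPartition S Ps → P (cost Ps)) → P (r′ S)
    r′-attained S P h with proj₁ (r′-min S)
    ... | _ , part , cost≡r′ = subst P cost≡r′ (h part)

    r′-∅ : r′ ∅ ≡ 0
    r′-∅ = n≤0⇒n≡0 (r′-≤-cost ([] , [] , refl))

    r′-∪-≤ : Disjoint A B → r′ (A ∪ B) ≤ f A + r′ B
    r′-∪-≤ {A = A} {B = B} A#B with nonempty? A
    ... | yes A≢∅ = r′-attained B (λ m → r′ (A ∪ B) ≤ f A + m) λ part →
      r′-≤-cost (∷-isPartition A≢∅ A#B part)
    ... | no A≡∅ = begin
      r′ (A ∪ B) ≡⟨ cong (λ C → r′ (C ∪ B)) (Empty-unique A≡∅) ⟩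
      r′ (∅ ∪ B) ≡⟨ cong r′ (∪-identityˡ B) ⟩
      r′ B       ≤⟨ m≤n+m (r′ B) (f A) ⟩
      f A + r′ B ∎

    r′-≤-f : ∀ A → r′ A ≤ f A
    r′-≤-f A = begin
      r′ A       ≡⟨ cong r′ (∪-identityʳ A) ⟨
      r′ (A ∪ ∅) ≤⟨ r′-∪-≤ (∩-zeroʳ A) ⟩
      f A + r′ ∅ ≡⟨ cong (f A +_) r′-∅ ⟩
      f A + 0    ≡⟨ +-identityʳ (f A) ⟩
      f A        ∎

    r′-split : A ⊆ S → r′ S ≤ f A + r′ (S ─ A)
    r′-split {A = A} {S = S} A⊆S =
      subst (λ T → r′ T ≤ f A + r′ (S ─ A)) (p⊆q⇒p∪[q─p]≡q A⊆S) (r′-∪-≤ Disjoint-─)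

    r′-bounded : (∀ x → f ⁅ x ⁆ ≤ 1) → ∀ S → r′ S ≤ ∣ S ∣
    r′-bounded f⁅x⁆≤1 = All.wfRec ⊂-wellFounded 0ℓ (λ S → r′ S ≤ ∣ S ∣) step
      where
      step : ∀ S → (∀ {T} → T ⊂ S → r′ T ≤ ∣ T ∣) → r′ S ≤ ∣ S ∣
      step S rec with nonempty? S
      ... | no S≡∅ = ≤-trans (≤-reflexive (trans (cong r′ (Empty-unique S≡∅)) r′-∅)) z≤n
      ... | yes (x , x∈S) = begin
        r′ S                 ≤⟨ r′-split (x∈p⇒⁅x⁆⊆p x∈S) ⟩
        f ⁅ x ⁆ + r′ (S - x) ≤⟨ +-mono-≤ (f⁅x⁆≤1 x) (rec (x∈p⇒p-x⊂p x∈S)) ⟩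
        1 + ∣ S - x ∣        ≤⟨ x∈p⇒∣p-x∣<∣p∣ x∈S ⟩
        ∣ S ∣                ∎

    r′-⋃∪-≤ : ∀ Ps → AllPairs Disjoint Ps → Disjoint (⋃ Ps) B → r′ (⋃ Ps ∪ B) ≤ cost Ps + r′ B
    r′-⋃∪-≤ {B = B} [] _ _ = ≤-reflexive (cong r′ (∪-identityˡ B))
    r′-⋃∪-≤ {B = B} (P ∷ Ps) (P#Ps ∷ Ps#) P∪U#B = begin
      r′ ((P ∪ U) ∪ B)       ≡⟨ cong r′ (∪-assoc P U B) ⟩
      r′ (P ∪ (U ∪ B))       ≤⟨ r′-∪-≤ P#U∪B ⟩
      f P + r′ (U ∪ B)       ≤⟨ +-monoʳ-≤ (f P) (r′-⋃∪-≤ Ps Ps# U#B) ⟩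
      f P + (cost Ps + r′ B) ≡⟨ +-assoc (f P) (cost Ps) (r′ B) ⟨
      f P + cost Ps + r′ B   ∎
      where
      U = ⋃ Ps
      U#B = Disjoint-mono (q⊆p∪q P U) ⊆-refl P∪U#B
      P#U∪B = Disjoint-∪ʳ (Disjoint-⋃⁺ Ps P#Ps) (Disjoint-mono (p⊆p∪q U) ⊆-refl P∪U#B)

    r′-subadditive : Disjoint A B → r′ (A ∪ B) ≤ r′ A + r′ B
    r′-subadditive {A = A} {B = B} A#B =
      r′-attained A (λ m → r′ (A ∪ B) ≤ m + r′ B) λ { {Ps} (_ , Ps# , refl) → r′-⋃∪-≤ Ps Ps# A#B }

    module _ (f-mono : ∀ {A B} → A ⊆ B → f A ≤ f B) where

      r′-≤-cost-of-cover : ∀ Ps → S ⊆ ⋃ Ps → r′ S ≤ cost Ps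
      r′-≤-cost-of-cover [] S⊆∅ = ≤-reflexive (trans (cong r′ (⊆-antisym S⊆∅ ⊥⊆)) r′-∅)
      r′-≤-cost-of-cover {S = S} (P ∷ Ps) S⊆P∪U = begin
        r′ S                         ≤⟨ r′-split (p∩q⊆p S P) ⟩
        f (S ∩ P) + r′ (S ─ S ∩ P)   ≤⟨ +-mono-≤ (f-mono (p∩q⊆q S P))
                                                 (r′-≤-cost-of-cover Ps (p⊆q∪r⇒p─p∩q⊆r S⊆P∪U)) ⟩
        f P + cost Ps                ∎

      r′-mono : S ⊆ T → r′ S ≤ r′ T
      r′-mono {S = S} {T = T} S⊆T =
        r′-attained T (r′ S ≤_) λ { {Ps} (_ , _ , refl) → r′-≤-cost-of-cover Ps S⊆T }

      module _ (f-submodular : ∀ A B → Nonempty (A ∩ B) → f (A ∪ B) + f (A ∩ B) ≤ f A + f B) where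

        r′-∪∩-≤-cost+f : ∀ Ws → AllPairs Disjoint Ws → ∀ B →
                         r′ (⋃ Ws ∪ B) + r′ (⋃ Ws ∩ B) ≤ cost Ws + f B
        r′-∪∩-≤-cost+f [] _ B = begin
          r′ (∅ ∪ B) + r′ (∅ ∩ B)
            ≡⟨ cong₂ _+_ (cong r′ (∪-identityˡ B)) (trans (cong r′ (∩-zeroˡ B)) r′-∅) ⟩
          r′ B + 0                ≡⟨ +-identityʳ (r′ B) ⟩
          r′ B                    ≤⟨ r′-≤-f B ⟩
          f B                     ∎
        r′-∪∩-≤-cost+f (W ∷ Ws) (W#Ws ∷ Ws#) B with nonempty? (W ∩ B)
        ... | no W∩B≡∅ = begin
          r′ ((W ∪ U) ∪ B) + r′ ((W ∪ U) ∩ B)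
            ≡⟨ cong₂ _+_ (cong r′ (∪-assoc W U B)) (cong r′ [W∪U]∩B≡U∩B) ⟩
          r′ (W ∪ (U ∪ B)) + r′ (U ∩ B)
            ≤⟨ +-monoˡ-≤ (r′ (U ∩ B)) (r′-∪-≤ (Disjoint-∪ʳ (Disjoint-⋃⁺ Ws W#Ws) W#B)) ⟩
          f W + r′ (U ∪ B) + r′ (U ∩ B)
            ≡⟨ +-assoc (f W) (r′ (U ∪ B)) (r′ (U ∩ B)) ⟩
          f W + (r′ (U ∪ B) + r′ (U ∩ B))
            ≤⟨ +-monoʳ-≤ (f W) (r′-∪∩-≤-cost+f Ws Ws# B) ⟩
          f W + (cost Ws + f B)
            ≡⟨ +-assoc (f W) (cost Ws) (f B) ⟨
          f W + cost Ws + f B ∎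
          where
          U = ⋃ Ws
          W#B = Empty-unique W∩B≡∅
          [W∪U]∩B≡U∩B : (W ∪ U) ∩ B ≡ U ∩ B
          [W∪U]∩B≡U∩B =
            trans (∩-distribʳ-∪ B W U) (trans (cong (_∪ (U ∩ B)) W#B) (∪-identityˡ (U ∩ B)))
        ... | yes W∩B≢∅ = begin
          r′ ((W ∪ U) ∪ B) + r′ ((W ∪ U) ∩ B)
            ≡⟨ cong₂ _+_ (cong r′ [W∪U]∪B≡U∪B′) (cong r′ (∩-distribʳ-∪ B W U)) ⟩
          r′ (U ∪ B′) + r′ ((W ∩ B) ∪ (U ∩ B))
            ≤⟨ +-monoʳ-≤ (r′ (U ∪ B′)) (r′-∪-≤ W∩B#U∩B) ⟩
          r′ (U ∪ B′) + (f (W ∩ B) + r′ (U ∩ B))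
            ≤⟨ +-monoʳ-≤ (r′ (U ∪ B′)) (+-monoʳ-≤ (f (W ∩ B)) (r′-mono U∩B⊆U∩B′)) ⟩
          r′ (U ∪ B′) + (f (W ∩ B) + r′ (U ∩ B′))
            ≡⟨ x∙yz≈xz∙y (r′ (U ∪ B′)) (f (W ∩ B)) (r′ (U ∩ B′)) ⟩
          r′ (U ∪ B′) + r′ (U ∩ B′) + f (W ∩ B)
            ≤⟨ +-monoˡ-≤ (f (W ∩ B)) (r′-∪∩-≤-cost+f Ws Ws# B′) ⟩
          cost Ws + f B′ + f (W ∩ B)
            ≡⟨ +-assoc (cost Ws) (f B′) (f (W ∩ B)) ⟩
          cost Ws + (f B′ + f (W ∩ B))
            ≤⟨ +-monoʳ-≤ (cost Ws) (f-submodular W B W∩B≢∅) ⟩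
          cost Ws + (f W + f B)
            ≡⟨ x∙yz≈yx∙z (cost Ws) (f W) (f B) ⟩
          f W + cost Ws + f B ∎
          where
          U = ⋃ Ws
          B′ = W ∪ B
          [W∪U]∪B≡U∪B′ : (W ∪ U) ∪ B ≡ U ∪ B′
          [W∪U]∪B≡U∪B′ = trans (cong (_∪ B) (∪-comm W U)) (∪-assoc U W B)
          U∩B⊆U∩B′ = ∩-mono-⊆ ⊆-refl (q⊆p∪q W B)
          W∩B#U∩B = Disjoint-mono (p∩q⊆p W B) (p∩q⊆p U B) (Disjoint-⋃⁺ Ws W#Ws)

        r′-∪∩-≤-r′+f : ∀ W B → r′ (W ∪ B) + r′ (W ∩ B) ≤ r′ W + f B
        r′-∪∩-≤-r′+f W B = r′-attained W (λ m → r′ (W ∪ B) + r′ (W ∩ B) ≤ m + f B)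
          λ { {Ws} (_ , Ws# , refl) → r′-∪∩-≤-cost+f Ws Ws# B }

        r′-∪∩-≤-r′+cost : ∀ Qs → AllPairs Disjoint Qs → ∀ X →
                          r′ (X ∪ ⋃ Qs) + r′ (X ∩ ⋃ Qs) ≤ r′ X + cost Qs
        r′-∪∩-≤-r′+cost [] _ X =
          ≤-reflexive (cong₂ _+_ (cong r′ (∪-identityʳ X)) (trans (cong r′ (∩-zeroʳ X)) r′-∅))
        r′-∪∩-≤-r′+cost (Q ∷ Qs) (Q#Qs ∷ Qs#) X = begin
          r′ (X ∪ (Q ∪ U)) + r′ (X ∩ (Q ∪ U))
            ≡⟨ cong₂ _+_ (cong r′ X∪[Q∪U]≡W∪Q) (cong r′ (∩-distribˡ-∪ X Q U)) ⟩
          r′ (W ∪ Q) + r′ ((X ∩ Q) ∪ (X ∩ U))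
            ≤⟨ +-monoʳ-≤ (r′ (W ∪ Q)) (r′-subadditive X∩Q#X∩U) ⟩
          r′ (W ∪ Q) + (r′ (X ∩ Q) + r′ (X ∩ U))
            ≤⟨ +-monoʳ-≤ (r′ (W ∪ Q)) (+-monoˡ-≤ (r′ (X ∩ U)) (r′-mono X∩Q⊆W∩Q)) ⟩
          r′ (W ∪ Q) + (r′ (W ∩ Q) + r′ (X ∩ U))
            ≡⟨ +-assoc (r′ (W ∪ Q)) (r′ (W ∩ Q)) (r′ (X ∩ U)) ⟨
          r′ (W ∪ Q) + r′ (W ∩ Q) + r′ (X ∩ U)
            ≤⟨ +-monoˡ-≤ (r′ (X ∩ U)) (r′-∪∩-≤-r′+f W Q) ⟩
          r′ W + f Q + r′ (X ∩ U)
            ≡⟨ xy∙z≈xz∙y (r′ W) (f Q) (r′ (X ∩ U)) ⟩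
          r′ W + r′ (X ∩ U) + f Q
            ≤⟨ +-monoˡ-≤ (f Q) (r′-∪∩-≤-r′+cost Qs Qs# X) ⟩
          r′ X + cost Qs + f Q
            ≡⟨ xy∙z≈x∙zy (r′ X) (cost Qs) (f Q) ⟩
          r′ X + (f Q + cost Qs) ∎
          where
          U = ⋃ Qs
          W = X ∪ U
          X∪[Q∪U]≡W∪Q : X ∪ (Q ∪ U) ≡ W ∪ Q
          X∪[Q∪U]≡W∪Q = trans (cong (X ∪_) (∪-comm Q U)) (sym (∪-assoc X U Q))
          X∩Q⊆W∩Q = ∩-mono-⊆ (p⊆p∪q U) ⊆-refl
          X∩Q#X∩U = Disjoint-mono (p∩q⊆q X Q) (p∩q⊆q X U) (Disjoint-⋃⁺ Qs Q#Qs)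

        r′-submodular : ∀ S T → r′ (S ∪ T) + r′ (S ∩ T) ≤ r′ S + r′ T
        r′-submodular S T = r′-attained T (λ m → r′ (S ∪ T) + r′ (S ∩ T) ≤ r′ S + m)
          λ { {Qs} (_ , Qs# , refl) → r′-∪∩-≤-r′+cost Qs Qs# S }

module _ (M : Matroid n) where
  open Matroid M renaming (rank to r)
  open IsRankFunction isRank
  open ≤-Reasoning

  2r∸1 : Subset n → ℕ
  2r∸1 A = 2 * r A ∸ 1

  2r∸1-mono : A ⊆ B → 2r∸1 A ≤ 2r∸1 B
  2r∸1-mono A⊆B = ∸-monoˡ-≤ 1 (*-monoʳ-≤ 2 (monotone A⊆B))

  2r∸1-⁅x⁆≤1 : ∀ x → 2r∸1 ⁅ x ⁆ ≤ 1
  2r∸1-⁅x⁆≤1 x = ∸-monoˡ-≤ 1 (*-monoʳ-≤ 2 (subst (r ⁅ x ⁆ ≤_) (∣⁅x⁆∣≡1 x) (bounded ⁅ x ⁆)))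

  module _ (loopless : Loopless M) where

    suc-2r∸1 : Nonempty A → suc (2r∸1 A) ≡ 2 * r A
    suc-2r∸1 (x , x∈A) = suc[2*m∸1]≡2*m (≤-trans (n≢0⇒n>0 (loopless x)) (monotone (x∈p⇒⁅x⁆⊆p x∈A)))
      where
      suc[2*m∸1]≡2*m : ∀ {m} → 1 ≤ m → suc (2 * m ∸ 1) ≡ 2 * m
      suc[2*m∸1]≡2*m (s≤s _) = refl

    2r∸1-submodular : ∀ A B → Nonempty (A ∩ B) → 2r∸1 (A ∪ B) + 2r∸1 (A ∩ B) ≤ 2r∸1 A + 2r∸1 B
    2r∸1-submodular A B (x , x∈A∩B) = s≤s⁻¹ (s≤s⁻¹ (begin
      suc (suc (2r∸1 (A ∪ B) + 2r∸1 (A ∩ B))) ≡⟨ cong suc (+-suc (2r∸1 (A ∪ B)) (2r∸1 (A ∩ B))) ⟨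
      suc (2r∸1 (A ∪ B)) + suc (2r∸1 (A ∩ B)) ≡⟨ cong₂ _+_ (suc-2r∸1 A∪B≢∅) (suc-2r∸1 (x , x∈A∩B)) ⟩
      2 * r (A ∪ B) + 2 * r (A ∩ B)           ≡⟨ *-distribˡ-+ 2 (r (A ∪ B)) (r (A ∩ B)) ⟨
      2 * (r (A ∪ B) + r (A ∩ B))             ≤⟨ *-monoʳ-≤ 2 (submodular A B) ⟩
      2 * (r A + r B)                         ≡⟨ *-distribˡ-+ 2 (r A) (r B) ⟩
      2 * r A + 2 * r B                       ≡⟨ cong₂ _+_ (suc-2r∸1 (x , x∈A)) (suc-2r∸1 (x , x∈B)) ⟨
      suc (2r∸1 A) + suc (2r∸1 B)             ≡⟨ cong suc (+-suc (2r∸1 A) (2r∸1 B)) ⟩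
      suc (suc (2r∸1 A + 2r∸1 B))             ∎))
      where
      x∈A = proj₁ (x∈p∩q⁻ A B x∈A∩B)
      x∈B = proj₂ (x∈p∩q⁻ A B x∈A∩B)
      A∪B≢∅ = x , p⊆p∪q B x∈A

theorem1p4 : (n : ℕ) (M : Matroid n) → Loopless M →
    Σ (Subset n → ℕ) λ r′ →
      (∀ S → IsMinOverPartitions (Matroid.rank M) S (r′ S)) × IsRankFunction r′
theorem1p4 n M loopless = r′ , r′-min , record
  { bounded    = r′-bounded (2r∸1-⁅x⁆≤1 M)
  ; monotone   = r′-mono (2r∸1-mono M)
  ; submodular = r′-submodular (2r∸1-mono M) (2r∸1-submodular M loopless)
  }
  where
  open PartitionCost (2r∸1 M)
  -- IsMinCost (2r∸1 M) unfolds to IsMinOverPartitions (Matroid.rank M).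
  r′ : Subset n → ℕ
  r′ S = proj₁ (minCost S)
  r′-min : ∀ S → IsMinCost S (r′ S)
  r′-min S = proj₂ (minCost S)
  open MinCostProperties r′ r′-min
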